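{- Let $G=\langle V,E,r\rangle$ be a trimmed and flat rooted directed graph with $n=n(G)$ nodes and $m=m(G)$ edges that admits fewer than $m^4$ arborescences. Let $A,B$ be two edge-disjoint arborescences of $G$ such that for every edge $(u,v)\in E$, $v$ is not an ancestor of $u$ in at least one of $A,B$. Then each of the trees $A$ and $B$ has $\mathcal{O}(\log n)$ leaves.
   Context: Parallel edges allowed, no loops. An arborescence is a set of $n-1$ edges such that every node is reachable from $r$ using only them, viewed as a tree rooted at $r$. An edge is nontrivial if it is in some but not all arborescences; trimmed means every edge is nontrivial; flat means at most two parallel copies of each edge. -}

module Defs where

open import Data.Nat using (ℕ; _<_; _≤_; _∸_; _^_)
open import Data.Fin using (Fin)
open import Data.Fin.Subset using (Subset; _∈_; _∉_; ∣_∣)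
open import Data.Product using (Σ; _×_; ∃)
open import Data.List using (List; length)
open import Data.List.Relation.Unary.All using (All)
open import Data.List.Relation.Unary.Unique.Propositional using (Unique)
open import Relation.Binary.PropositionalEquality using (_≡_; _≢_)
open import Relation.Nullary using (¬_)
open import Data.Empty using (⊥)

-- A rooted directed multigraph: nodes Fin n, edges Fin m (parallel edges
-- allowed since edges are indices), edge e goes from src e to tgt e,
-- no loops, root r.
record RootedGraph (n m : ℕ) : Set where
  field
    src     : Fin m → Fin n
    tgt     : Fin m → Fin n
    noLoops : ∀ e → src e ≢ tgt e
    root    : Fin n
open RootedGraph public

module _ {n m : ℕ} (G : RootedGraph n m) where

  data Path (S : Subset m) : Fin n → Fin n → Set where
    here : ∀ {a} → Path S a a
    step : ∀ {a} e {b} → e ∈ S → src G e ≡ a → Path S (tgt G e) b → Path S a b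

  IsArborescence : Subset m → Set
  IsArborescence S = (∣ S ∣ ≡ n ∸ 1) × (∀ v → Path S (root G) v)

  Ancestor : Subset m → Fin n → Fin n → Set
  Ancestor S a b = Path S a b

  Nontrivial : Fin m → Set
  Nontrivial e = (∃ λ S → IsArborescence S × e ∈ S)
               × (∃ λ S → IsArborescence S × e ∉ S)

  Trimmed : Set
  Trimmed = ∀ e → Nontrivial e

  -- At most two parallel copies of each edge.
  Flat : Set
  Flat = ∀ e₁ e₂ e₃ → e₁ ≢ e₂ → e₁ ≢ e₃ → e₂ ≢ e₃ →
         src G e₁ ≡ src G e₂ → tgt G e₁ ≡ tgt G e₂ →
         src G e₁ ≡ src G e₃ → tgt G e₁ ≡ tgt G e₃ → ⊥

  FewerArborescencesThan : ℕ → Set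
  FewerArborescencesThan k =
    ∀ (L : List (Subset m)) → Unique L → All IsArborescence L → length L < k

  EdgeDisjoint : Subset m → Subset m → Set
  EdgeDisjoint A B = ∀ e → ¬ (e ∈ A × e ∈ B)

  IsLeaf : Subset m → Fin n → Set
  IsLeaf S v = ∀ e → e ∈ S → src G e ≢ v

  LeavesAtMost : Subset m → ℕ → Set
  LeavesAtMost S k = ∀ (L : List (Fin n)) → Unique L → All (IsLeaf S) L → length L ≤ k

{-# OPTIONS --safe #-}

-- Let A and B be edge-disjoint arborescences and X a set of non-root leaves of A. Giving every node
-- of X its in-edges from B and every other node its in-edges from A yields again an arborescence:
-- in an arborescence each non-root node has in-degree exactly one, so the result has n - 1 edges; an
-- A-path never passes through a leaf, so the nodes outside X stay reachable, and a node of X is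
-- reached along the final stretch of its B-path, whose edges all enter X. The A-edge entering a leaf
-- records whether the leaf lies in X, so the 2^ℓ choices of X (ℓ the number of non-root leaves) give
-- distinct arborescences. Hence 2^ℓ < m⁴ ≤ (2n²)⁴, flatness giving m ≤ 2n², and ℓ = O(log n).

module Submission where

open import Defs
open import Data.Bool using (Bool; true; false; T; not; _∧_; if_then_else_)
open import Data.Bool.Properties using (∧-zeroʳ; not-injective)
open import Data.Empty using (⊥; ⊥-elim)
open import Data.Fin using (Fin; zero; suc; _≟_)
open import Data.Fin.Properties using (suc-injective)
open import Data.Fin.Subset using (Subset; _∈_; ∣_∣; inside; outside) renaming (⊥ to ∅)
open import Data.List using (List; []; _∷_; _++_; length; map)
open import Data.List.Properties using (length-map; length-++)
open import Data.List.Membership.Propositional using () renaming (_∈_ to _∈ₗ_)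
open import Data.List.Relation.Unary.Any using (here; there; any?)
open import Data.List.Relation.Unary.All as All using (All; []; _∷_)
import Data.List.Relation.Unary.All.Properties as All
open import Data.List.Relation.Unary.AllPairs as AllPairs using (AllPairs; []; _∷_)
import Data.List.Relation.Unary.AllPairs.Properties as AllPairs
open import Data.List.Relation.Unary.Unique.Propositional using (Unique)
import Data.List.Relation.Unary.Unique.Propositional.Properties as Unique
open import Data.Nat using (ℕ; zero; suc; _+_; _*_; _^_; _∸_; _≤_; _<_; z≤n; s≤s; _≤?_; NonZero)
open import Data.Nat.Properties
  using ( +-0-commutativeMonoid; +-comm; +-identityʳ; *-comm; *-identityʳ; ^-*-assoc
        ; ≤-reflexive; ≤-trans; ≤-antisym; ≤-pred; <⇒≤; <⇒≱; ≰⇒>; <-≤-trans; 1+n≰n; m≤m+n; m≤n+m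
        ; +-mono-≤; +-monoˡ-≤; +-monoʳ-≤; +-cancelˡ-≤; +-cancelʳ-≤; *-mono-≤; ^-monoˡ-≤; ^-monoʳ-≤
        ; m+n∸m≡n; module ≤-Reasoning )
open import Data.Nat.Logarithm using (⌊log₂_⌋; ⌊log₂⌋-mono-≤; ⌊log₂[2^n]⌋≡n)
open import Data.Product using (Σ; _×_; _,_; proj₂; ∃-syntax; swap)
open import Data.Sum using (_⊎_)
open import Data.Unit using (tt)
open import Data.Vec using ([]; _∷_; lookup; tabulate; _[_]≔_)
open import Data.Vec.Properties
  using (lookup∘tabulate; []=⇒lookup; lookup⇒[]=; lookup∘update; lookup∘update′; lookup-replicate)
open import Function using (_∘_)
open import Relation.Binary.PropositionalEquality
open import Relation.Nullary using (does; yes; no; contradiction)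
open import Relation.Nullary.Decidable using (dec-true)
open import Relation.Nullary.Irrelevant using (Irrelevant)

open import Algebra.Properties.CommutativeMonoid.Sum +-0-commutativeMonoid
  using (sum; sum-syntax; ∑-distrib-+; sum-cong-≗; sum-replicate-zero)

∑-mono-≤ : ∀ {k} {f g : Fin k → ℕ} → (∀ i → f i ≤ g i) → sum f ≤ sum g
∑-mono-≤ {zero}  f≤g = z≤n
∑-mono-≤ {suc k} f≤g = +-mono-≤ (f≤g zero) (∑-mono-≤ (f≤g ∘ suc))

∑-const : ∀ k c → ∑[ i < k ] c ≡ k * c
∑-const zero    c = refl
∑-const (suc k) c = cong (c +_) (∑-const k c)

term≤∑ : ∀ {k} (f : Fin k → ℕ) i → f i ≤ sum f
term≤∑ f zero    = m≤m+n _ _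
term≤∑ f (suc i) = ≤-trans (term≤∑ (f ∘ suc) i) (m≤n+m _ _)

+-≤-tight : ∀ {a b c d} → a ≤ c → b ≤ d → c + d ≤ a + b → c ≤ a × d ≤ b
+-≤-tight {a} {b} {c} {d} a≤c b≤d c+d≤a+b =
  +-cancelʳ-≤ d c a (≤-trans c+d≤a+b (+-monoʳ-≤ a b≤d)) ,
  +-cancelˡ-≤ c d b (≤-trans c+d≤a+b (+-monoˡ-≤ b a≤c))

∑-≤-tight : ∀ {k} {f g : Fin k → ℕ} → (∀ i → f i ≤ g i) → sum g ≤ sum f → ∀ i → f i ≡ g i
∑-≤-tight {suc k} f≤g ∑g≤∑f =
  let g₀≤f₀ , ∑g′≤∑f′ = +-≤-tight (f≤g zero) (∑-mono-≤ (f≤g ∘ suc)) ∑g≤∑f in λ where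
    zero    → ≤-antisym (f≤g zero) g₀≤f₀
    (suc i) → ∑-≤-tight (f≤g ∘ suc) ∑g′≤∑f′ i

n<2^[1+⌊log₂n⌋] : ∀ n → n < 2 ^ suc ⌊log₂ n ⌋
n<2^[1+⌊log₂n⌋] n with 2 ^ suc ⌊log₂ n ⌋ ≤? n
... | no  2^[1+ℓ]≰n = ≰⇒> 2^[1+ℓ]≰n
... | yes 2^[1+ℓ]≤n =
  contradiction (subst (_≤ ⌊log₂ n ⌋) (⌊log₂[2^n]⌋≡n _) (⌊log₂⌋-mono-≤ 2^[1+ℓ]≤n)) (1+n≰n)

^-cancelˡ-< : ∀ b .{{_ : NonZero b}} {x y} → b ^ x < b ^ y → x < y
^-cancelˡ-< b {x} {y} bˣ<bʸ with y ≤? x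
... | yes y≤x = contradiction (^-monoʳ-≤ b y≤x) (<⇒≱ bˣ<bʸ)
... | no  y≰x = ≰⇒> y≰x

-- With P = 2^(1 + ⌊log₂ n⌋) > n we get m ≤ 2n² ≤ P³, hence 2^k < m⁴ ≤ P¹².
exponent≤12log₂ : ∀ {n m k} → m ≤ n * (n * 2) → 2 ^ k < m ^ 4 → k ≤ 12 * ⌊log₂ n ⌋ + 12
exponent≤12log₂ {n} {m} {k} m≤2n² 2ᵏ<m⁴ = begin
  k               ≤⟨ <⇒≤ (^-cancelˡ-< 2 (<-≤-trans 2ᵏ<m⁴ m⁴≤2^[[1+ℓ]*12])) ⟩
  12 + ℓ * 12     ≡⟨ +-comm 12 (ℓ * 12) ⟩
  ℓ * 12 + 12     ≡⟨ cong (_+ 12) (*-comm ℓ 12) ⟩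
  12 * ℓ + 12     ∎
  where
  open ≤-Reasoning
  ℓ = ⌊log₂ n ⌋
  P = 2 ^ suc ℓ
  n≤P : n ≤ P
  n≤P = <⇒≤ (n<2^[1+⌊log₂n⌋] n)
  m⁴≤2^[[1+ℓ]*12] : m ^ 4 ≤ 2 ^ (suc ℓ * 12)
  m⁴≤2^[[1+ℓ]*12] = begin
    m ^ 4         ≤⟨ ^-monoˡ-≤ 4 (≤-trans m≤2n² (*-mono-≤ n≤P (*-mono-≤ n≤P 2≤P))) ⟩
    (P ^ 3) ^ 4   ≡⟨ ^-*-assoc P 3 4 ⟩
    P ^ 12        ≡⟨ ^-*-assoc 2 (suc ℓ) 12 ⟩
    2 ^ (suc ℓ * 12) ∎
    where
    2≤P : 2 ≤ P * 1
    2≤P = subst (2 ≤_) (sym (*-identityʳ P)) (^-monoʳ-≤ 2 {1} {suc ℓ} (s≤s z≤n))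

count : ∀ {k} → (Fin k → Bool) → ℕ
count {k} p = ∑[ i < k ] (if p i then 1 else 0)

∣p∣≡count : ∀ {k} (S : Subset k) → ∣ S ∣ ≡ count (lookup S)
∣p∣≡count []          = refl
∣p∣≡count (true ∷ S)  = cong suc (∣p∣≡count S)
∣p∣≡count (false ∷ S) = ∣p∣≡count S

count-cong : ∀ {k} {p q : Fin k → Bool} → (∀ i → p i ≡ q i) → count p ≡ count q
count-cong p≗q = sum-cong-≗ (λ i → cong (if_then 1 else 0) (p≗q i))

count-≟ : ∀ {k} (i : Fin k) → count (λ j → does (i ≟ j)) ≡ 1
count-≟ {suc k} zero    = cong suc (sum-replicate-zero k)
count-≟ {suc k} (suc i) = count-≟ i

count-complement : ∀ {k} (p : Fin k → Bool) → count p + count (not ∘ p) ≡ k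
count-complement {k} p = begin
  count p + count (not ∘ p)                                   ≡⟨ ∑-distrib-+ (λ i → if p i then 1 else 0) _ ⟨
  ∑[ i < k ] ((if p i then 1 else 0) + (if not (p i) then 1 else 0)) ≡⟨ sum-cong-≗ (λ i → one-of (p i)) ⟩
  ∑[ i < k ] 1                                                ≡⟨ ∑-const k 1 ⟩
  k * 1                                                       ≡⟨ *-identityʳ k ⟩
  k                                                           ∎
  where
  open ≡-Reasoning
  one-of : ∀ b → (if b then 1 else 0) + (if not b then 1 else 0) ≡ 1
  one-of true  = refl
  one-of false = refl

count-≥1 : ∀ {k} (p : Fin k → Bool) {i} → p i ≡ true → 1 ≤ count p
count-≥1 p {i} pᵢ = subst (λ b → (if b then 1 else 0) ≤ count p) pᵢ (term≤∑ _ i)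

count-partition : ∀ {k l} (f : Fin k → Fin l) (p : Fin k → Bool) →
                  count p ≡ ∑[ j < l ] count (λ i → p i ∧ does (f i ≟ j))
count-partition {zero}  {l} f p = sym (sum-replicate-zero l)
count-partition {suc k} {l} f p = begin
  (if p zero then 1 else 0) + count (p ∘ suc)
    ≡⟨ cong₂ _+_ (sym first-fibre) (count-partition (f ∘ suc) (p ∘ suc)) ⟩
  ∑[ j < l ] (if p zero ∧ does (f zero ≟ j) then 1 else 0)
    + ∑[ j < l ] count (λ i → p (suc i) ∧ does (f (suc i) ≟ j))
    ≡⟨ sym (∑-distrib-+ (λ j → if p zero ∧ does (f zero ≟ j) then 1 else 0) _) ⟩
  ∑[ j < l ] count (λ i → p i ∧ does (f i ≟ j)) ∎
  where
  open ≡-Reasoning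
  first-fibre : ∑[ j < l ] (if p zero ∧ does (f zero ≟ j) then 1 else 0) ≡ (if p zero then 1 else 0)
  first-fibre with p zero
  ... | true  = count-≟ (f zero)
  ... | false = sum-replicate-zero l

count-≤ : ∀ {k} b (p : Fin k → Bool) →
          (∀ L → Unique L → All (T ∘ p) L → length L ≤ b) → count p ≤ b
count-≤ {zero} b p bound = z≤n
count-≤ {suc k} b p bound with p zero in p₀
... | false = count-≤ b (p ∘ suc) λ L u ps →
  subst (_≤ b) (length-map suc L) (bound (map suc L) (Unique.map⁺ suc-injective u) (All.map⁺ ps))
count-≤ {suc k} zero    p bound | true = ⊥-elim (1+n≰n (bound (zero ∷ []) ([] ∷ []) (subst T (sym p₀) tt ∷ [])))
count-≤ {suc k} (suc b) p bound | true = s≤s (count-≤ b (p ∘ suc) λ L u ps →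
  ≤-pred (subst (_≤ suc b) (cong suc (length-map suc L))
    (bound (zero ∷ map suc L)
           (All.map⁺ (All.universal (λ _ ()) L) ∷ Unique.map⁺ suc-injective u)
           (subst T (sym p₀) tt ∷ All.map⁺ ps))))

Unique⇒length≤1 : ∀ {A : Set} {xs : List A} → Irrelevant A → Unique xs → length xs ≤ 1
Unique⇒length≤1 {xs = []}         _   _                = z≤n
Unique⇒length≤1 {xs = _ ∷ []}     _   _                = s≤s z≤n
Unique⇒length≤1 {xs = x ∷ y ∷ _}  irr ((x≢y ∷ _) ∷ _) = contradiction (irr x y) x≢y

subsetsOf : ∀ {n} → List (Fin n) → List (Subset n)
subsetsOf []      = ∅ ∷ []
subsetsOf (v ∷ L) = map (_[ v ]≔ inside) (subsetsOf L) ++ map (_[ v ]≔ outside) (subsetsOf L)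

length-subsetsOf : ∀ {n} (L : List (Fin n)) → length (subsetsOf L) ≡ 2 ^ length L
length-subsetsOf []      = refl
length-subsetsOf (v ∷ L) = begin
  length (map (_[ v ]≔ inside) (subsetsOf L) ++ map (_[ v ]≔ outside) (subsetsOf L))
    ≡⟨ length-++ (map (_[ v ]≔ inside) (subsetsOf L)) ⟩
  length (map (_[ v ]≔ inside) (subsetsOf L)) + length (map (_[ v ]≔ outside) (subsetsOf L))
    ≡⟨ cong₂ _+_ (length-map _ (subsetsOf L)) (length-map _ (subsetsOf L)) ⟩
  length (subsetsOf L) + length (subsetsOf L)
    ≡⟨ cong (λ k → k + k) (length-subsetsOf L) ⟩
  2 ^ length L + 2 ^ length L
    ≡⟨ cong (2 ^ length L +_) (+-identityʳ (2 ^ length L)) ⟨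
  2 ^ length (v ∷ L) ∎
  where open ≡-Reasoning

subsetsOf-⊆ : ∀ {n} (L : List (Fin n)) → All (λ X → ∀ u → lookup X u ≡ true → u ∈ₗ L) (subsetsOf L)
subsetsOf-⊆ []      = (λ u ∅ᵤ → contradiction (trans (sym (lookup-replicate u false)) ∅ᵤ) λ ()) ∷ []
subsetsOf-⊆ (v ∷ L) = All.++⁺ (All.map⁺ (All.map (λ {X} → extend inside X) (subsetsOf-⊆ L)))
                              (All.map⁺ (All.map (λ {X} → extend outside X) (subsetsOf-⊆ L)))
  where
  extend : ∀ b X → (∀ u → lookup X u ≡ true → u ∈ₗ L) →
           ∀ u → lookup (X [ v ]≔ b) u ≡ true → u ∈ₗ v ∷ L
  extend b X X⊆L u Xᵤ with u ≟ v
  ... | yes refl = here refl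
  ... | no  u≢v  = there (X⊆L u (trans (sym (lookup∘update′ u≢v X b)) Xᵤ))

DifferOn : ∀ {n} → List (Fin n) → Subset n → Subset n → Set
DifferOn L X Y = ∃[ v ] v ∈ₗ L × lookup X v ≢ lookup Y v

subsetsOf-differ : ∀ {n} {L : List (Fin n)} → Unique L → AllPairs (DifferOn L) (subsetsOf L)
subsetsOf-differ {L = []}    _           = [] ∷ []
subsetsOf-differ {L = v ∷ L} (v∉L ∷ uL) =
  AllPairs.++⁺ (AllPairs.map⁺ (AllPairs.map (λ {X Y} → extend inside X Y) (subsetsOf-differ uL)))
               (AllPairs.map⁺ (AllPairs.map (λ {X Y} → extend outside X Y) (subsetsOf-differ uL)))
               across
  where
  extend : ∀ b X Y → DifferOn L X Y → DifferOn (v ∷ L) (X [ v ]≔ b) (Y [ v ]≔ b)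
  extend b X Y (w , w∈L , Xw≢Yw) = w , there w∈L , λ eq →
    Xw≢Yw (trans (sym (lookup∘update′ w≢v X b)) (trans eq (lookup∘update′ w≢v Y b)))
    where
    w≢v : w ≢ v
    w≢v w≡v = All.lookup v∉L w∈L (sym w≡v)
  differ-at-v : ∀ X Y → lookup (X [ v ]≔ inside) v ≢ lookup (Y [ v ]≔ outside) v
  differ-at-v X Y eq with trans (sym (lookup∘update v X inside)) (trans eq (lookup∘update v Y outside))
  ... | ()
  across : All (λ X → All (DifferOn (v ∷ L) X) (map (_[ v ]≔ outside) (subsetsOf L)))
               (map (_[ v ]≔ inside) (subsetsOf L))
  across = All.map⁺ (All.universal (λ X → All.map⁺ (All.universal (λ Y → v , here refl , differ-at-v X Y) _)) _)

module _ {n m : ℕ} (G : RootedGraph n m) where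

  snoc : ∀ {S a b e} → Path G S a b → e ∈ S → src G e ≡ b → Path G S a (tgt G e)
  snoc here              e∈S srcₑ = step _ e∈S srcₑ here
  snoc (step e′ e′∈S s p) e∈S srcₑ = step e′ e′∈S s (snoc p e∈S srcₑ)

  lastEdge : ∀ {S a b} → Path G S a b → a ≢ b → ∃[ e ] e ∈ S × tgt G e ≡ b
  lastEdge here              a≢a = contradiction refl a≢a
  lastEdge {b = b} (step e e∈S _ p) _ with tgt G e ≟ b
  ... | yes tgtₑ = e , e∈S , tgtₑ
  ... | no  tgtₑ≢b = lastEdge p tgtₑ≢b

  path-from-leaf : ∀ {S a b} → IsLeaf G S a → Path G S a b → a ≡ b
  path-from-leaf leaf here             = refl
  path-from-leaf leaf (step e e∈S s _) = contradiction s (leaf e e∈S)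

  indeg : Subset m → Fin n → ℕ
  indeg S v = count (λ e → lookup S e ∧ does (tgt G e ≟ v))

  ∣S∣≡∑indeg : ∀ S → ∣ S ∣ ≡ ∑[ v < n ] indeg S v
  ∣S∣≡∑indeg S = trans (∣p∣≡count S) (count-partition (tgt G) (lookup S))

  nonRoot : Fin n → Bool
  nonRoot v = not (does (root G ≟ v))

  count-nonRoot : count nonRoot ≡ n ∸ 1
  count-nonRoot = begin
    count nonRoot                         ≡⟨ m+n∸m≡n 1 _ ⟨
    1 + count nonRoot ∸ 1                 ≡⟨ cong (λ k → k + count nonRoot ∸ 1) (count-≟ (root G)) ⟨
    count isRoot + count nonRoot ∸ 1      ≡⟨ cong (_∸ 1) (count-complement isRoot) ⟩
    n ∸ 1                                 ∎
    where
    open ≡-Reasoning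
    isRoot : Fin n → Bool
    isRoot v = does (root G ≟ v)

  -- Every non-root node is entered by some edge of S, and the in-degrees add up to ∣ S ∣ = n ∸ 1.
  indeg-arborescence : ∀ {S} → IsArborescence G S → ∀ v → indeg S v ≡ (if nonRoot v then 1 else 0)
  indeg-arborescence {S} (∣S∣≡n∸1 , reach) v = sym (∑-≤-tight entered (≤-reflexive total) v)
    where
    entered : ∀ v → (if nonRoot v then 1 else 0) ≤ indeg S v
    entered v with root G ≟ v
    ... | yes _   = z≤n
    ... | no  r≢v with e , e∈S , tgtₑ ← lastEdge (reach v) r≢v =
      count-≥1 (λ e → lookup S e ∧ does (tgt G e ≟ v))
               (cong₂ _∧_ ([]=⇒lookup e∈S) (dec-true (tgt G e ≟ v) tgtₑ))
    total : ∑[ v < n ] indeg S v ≡ count nonRoot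
    total = trans (sym (∣S∣≡∑indeg S)) (trans ∣S∣≡n∸1 (sym count-nonRoot))

  splice : (Fin n → Subset m) → Subset m
  splice S = tabulate (λ e → lookup (S (tgt G e)) e)

  ∈-splice : ∀ {S e} → e ∈ S (tgt G e) → e ∈ splice S
  ∈-splice {S} {e} e∈S = lookup⇒[]= e _ (trans (lookup∘tabulate _ e) ([]=⇒lookup e∈S))

  indeg-splice : ∀ S v → indeg (splice S) v ≡ indeg (S v) v
  indeg-splice S v = count-cong same-term
    where
    same-term : ∀ e → lookup (splice S) e ∧ does (tgt G e ≟ v) ≡ lookup (S v) e ∧ does (tgt G e ≟ v)
    same-term e rewrite lookup∘tabulate (λ e → lookup (S (tgt G e)) e) e with tgt G e ≟ v
    ... | yes refl = refl
    ... | no  _    = trans (∧-zeroʳ _) (sym (∧-zeroʳ _))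

  ∣splice∣≡n∸1 : ∀ S → (∀ v → IsArborescence G (S v)) → ∣ splice S ∣ ≡ n ∸ 1
  ∣splice∣≡n∸1 S arb = begin
    ∣ splice S ∣                   ≡⟨ ∣S∣≡∑indeg (splice S) ⟩
    ∑[ v < n ] indeg (splice S) v
      ≡⟨ sum-cong-≗ (λ v → trans (indeg-splice S v) (indeg-arborescence (arb v) v)) ⟩
    count nonRoot                  ≡⟨ count-nonRoot ⟩
    n ∸ 1                          ∎
    where open ≡-Reasoning

parallel-edges≤2 : ∀ {n m} (G : RootedGraph n m) → Flat G → ∀ a b (L : List (Fin m)) → Unique L →
                   All (λ e → src G e ≡ a × tgt G e ≡ b) L → length L ≤ 2
parallel-edges≤2 G flat a b []           _ _ = z≤n
parallel-edges≤2 G flat a b (_ ∷ [])     _ _ = s≤s z≤n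
parallel-edges≤2 G flat a b (_ ∷ _ ∷ []) _ _ = s≤s (s≤s z≤n)
parallel-edges≤2 G flat a b (e₁ ∷ e₂ ∷ e₃ ∷ _)
  ((e₁≢e₂ ∷ e₁≢e₃ ∷ _) ∷ (e₂≢e₃ ∷ _) ∷ _) ((s₁ , t₁) ∷ (s₂ , t₂) ∷ (s₃ , t₃) ∷ _) =
  ⊥-elim (flat e₁ e₂ e₃ e₁≢e₂ e₁≢e₃ e₂≢e₃
               (trans s₁ (sym s₂)) (trans t₁ (sym t₂)) (trans s₁ (sym s₃)) (trans t₁ (sym t₃)))

flat⇒m≤n*[n*2] : ∀ {n m} (G : RootedGraph n m) → Flat G → m ≤ n * (n * 2)
flat⇒m≤n*[n*2] {n} {m} G flat = begin
  m                                             ≡⟨ trans (∑-const m 1) (*-identityʳ m) ⟨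
  count {m} (λ _ → true)                        ≡⟨ count-partition (src G) (λ _ → true) ⟩
  ∑[ a < n ] count (λ e → does (src G e ≟ a))
    ≡⟨ sum-cong-≗ (λ a → count-partition (tgt G) (λ e → does (src G e ≟ a))) ⟩
  ∑[ a < n ] ∑[ b < n ] count (parallel a b)
    ≤⟨ ∑-mono-≤ (λ a → ∑-mono-≤ (λ b → count-≤ 2 (parallel a b) (λ L uniq parallel →
         parallel-edges≤2 G flat a b L uniq (All.map (fibre a b) parallel)))) ⟩
  ∑[ a < n ] ∑[ b < n ] 2                       ≡⟨ trans (sum-cong-≗ {n} (λ a → ∑-const n 2)) (∑-const n (n * 2)) ⟩
  n * (n * 2)                                   ∎
  where
  open ≤-Reasoning
  parallel : Fin n → Fin n → Fin m → Bool
  parallel a b e = does (src G e ≟ a) ∧ does (tgt G e ≟ b)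
  fibre : ∀ a b {e} → T (parallel a b e) → src G e ≡ a × tgt G e ≡ b
  fibre a b {e} t with src G e ≟ a | tgt G e ≟ b
  ... | yes sₑ | yes tₑ = sₑ , tₑ
  ... | yes _  | no _   = ⊥-elim t
  ... | no _   | _      = ⊥-elim t

module Exchange {n m : ℕ} (G : RootedGraph n m) {A B : Subset m}
                (arbA : IsArborescence G A) (arbB : IsArborescence G B)
                (disjoint : EdgeDisjoint G A B) where

  donor : Subset n → Fin n → Subset m
  donor X w = if lookup X w then B else A

  exchange : Subset n → Subset m
  exchange X = splice G (donor X)

  lookup-exchange-A : ∀ X {a} → a ∈ A → lookup (exchange X) a ≡ not (lookup X (tgt G a))
  lookup-exchange-A X {a} a∈A rewrite lookup∘tabulate (λ e → lookup (donor X (tgt G e)) e) a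
    with lookup X (tgt G a)
  ... | false = []=⇒lookup a∈A
  ... | true  with lookup B a in a∈?B
  ...   | false = refl
  ...   | true  = contradiction (a∈A , lookup⇒[]= a B a∈?B) (disjoint a)

  exchange-injectiveAt : ∀ {X Y v} → root G ≢ v → exchange X ≡ exchange Y → lookup X v ≡ lookup Y v
  exchange-injectiveAt {X} {Y} r≢v eq with a , a∈A , refl ← lastEdge G (proj₂ arbA _) r≢v =
    not-injective (trans (sym (lookup-exchange-A X a∈A))
                         (trans (cong (λ T → lookup T a) eq) (lookup-exchange-A Y a∈A)))

  ∈-exchange : ∀ X {e b} → lookup X (tgt G e) ≡ b → e ∈ (if b then B else A) → e ∈ exchange X
  ∈-exchange X {e} Xₜ e∈ = ∈-splice G {donor X} (subst (λ b → e ∈ (if b then B else A)) (sym Xₜ) e∈)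

  module _ {X : Subset n} (leaves : ∀ u → lookup X u ≡ true → IsLeaf G A u) where

    reach-outside : ∀ {x w} → Path G A x w → lookup X w ≡ false → Path G (exchange X) x w
    reach-outside here _ = here
    reach-outside {w = w} (step e e∈A srcₑ p) Xw≡false with lookup X (tgt G e) in Xₜ
    ... | false = step e (∈-exchange X Xₜ e∈A) srcₑ (reach-outside p Xw≡false)
    ... | true  = contradiction (trans (sym Xₜ) (trans (cong (lookup X) tgtₑ≡w) Xw≡false)) λ ()
      where
      tgtₑ≡w : tgt G e ≡ w
      tgtₑ≡w = path-from-leaf G (leaves _ Xₜ) p

    reach-along-B : ∀ {x w} → Path G B x w → Path G (exchange X) (root G) x → Path G (exchange X) (root G) w
    reach-along-B here                  reach-x = reach-x
    reach-along-B (step e e∈B srcₑ p) reach-x with lookup X (tgt G e) in Xₜ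
    ... | true  = reach-along-B p (snoc G reach-x (∈-exchange X Xₜ e∈B) srcₑ)
    ... | false = reach-along-B p (reach-outside (proj₂ arbA _) Xₜ)

    exchange-arborescence : IsArborescence G (exchange X)
    exchange-arborescence = ∣splice∣≡n∸1 G (donor X) donor-arborescence , reach
      where
      donor-arborescence : ∀ w → IsArborescence G (donor X w)
      donor-arborescence w with lookup X w
      ... | true  = arbB
      ... | false = arbA
      reach : ∀ w → Path G (exchange X) (root G) w
      reach w with lookup X w in Xw
      ... | true  = reach-along-B (proj₂ arbB w) here
      ... | false = reach-outside (proj₂ arbA w) Xw

  2^leaves<arborescences : ∀ {k} {L : List (Fin n)} → Unique L → All (IsLeaf G A) L → All (root G ≢_) L →
                           FewerArborescencesThan G k → 2 ^ length L < k
  2^leaves<arborescences {L = L} uniq leaves nonRoots few =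
    subst (_< _) (trans (length-map exchange (subsetsOf L)) (length-subsetsOf L))
      (few (map exchange (subsetsOf L))
           (AllPairs.map⁺ (AllPairs.map (λ {X Y} → distinct X Y) (subsetsOf-differ uniq)))
           (All.map⁺ (All.map (λ {X} X⊆L → exchange-arborescence {X} (λ u Xᵤ → All.lookup leaves (X⊆L u Xᵤ)))
                              (subsetsOf-⊆ L))))
    where
    distinct : ∀ X Y → DifferOn L X Y → exchange X ≢ exchange Y
    distinct X Y (v , v∈L , Xᵥ≢Yᵥ) = Xᵥ≢Yᵥ ∘ exchange-injectiveAt {X} {Y} (All.lookup nonRoots v∈L)

few-arborescences⇒few-leaves : ∀ {n m} (G : RootedGraph n m) → Flat G → FewerArborescencesThan G (m ^ 4) →
  ∀ {A B} → IsArborescence G A → IsArborescence G B → EdgeDisjoint G A B →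
  LeavesAtMost G A (12 * ⌊log₂ n ⌋ + 12)
few-arborescences⇒few-leaves {n} G flat few arbA arbB disjoint L uniq leaves with any? (root G ≟_) L
-- The root is a leaf of A only if it is the only node.
... | yes r∈L = ≤-trans (Unique⇒length≤1 (λ u v → trans (sym (only-root u)) (only-root v)) uniq)
                        (≤-trans (s≤s z≤n) (m≤n+m 12 _))
  where
  only-root : ∀ v → root G ≡ v
  only-root v = path-from-leaf G (All.lookup leaves r∈L) (proj₂ arbA v)
... | no  r∉L = exponent≤12log₂ {n} (flat⇒m≤n*[n*2] G flat)
                  (Exchange.2^leaves<arborescences G arbA arbB disjoint uniq leaves (All.¬Any⇒All¬ L r∉L) few)

lemma13 : Σ ℕ λ c →
    ∀ {n m : ℕ} (G : RootedGraph n m) →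
    Trimmed G → Flat G → FewerArborescencesThan G (m ^ 4) →
    (A B : Subset m) → IsArborescence G A → IsArborescence G B →
    EdgeDisjoint G A B →
    (∀ e → (Ancestor G A (tgt G e) (src G e) → ⊥) ⊎ (Ancestor G B (tgt G e) (src G e) → ⊥)) →
    LeavesAtMost G A (c * ⌊log₂ n ⌋ + c) × LeavesAtMost G B (c * ⌊log₂ n ⌋ + c)
lemma13 = 12 , λ G _ flat few A B arbA arbB disjoint _ →
  few-arborescences⇒few-leaves G flat few arbA arbB disjoint ,
  few-arborescences⇒few-leaves G flat few arbB arbA (λ e → disjoint e ∘ swap)
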